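{- Let $h \geq 3$ be an integer and let $A = \{a_1, \ldots, a_{h+1}\}$ be a set of positive integers with $a_1 < \cdots < a_{h+1}$. Assume that $a_1 \equiv a_2 \pmod 2$ and $a_r \not\equiv a_1 \pmod 2$ for some $r \in \{3, \ldots, h+1\}$. Then, with $A_r = A \setminus \{a_r\}$, \[|h^{\wedge}_{\pm}A| \geq |h^{\wedge}_{\pm}A_r| + \frac{h(h+1)}{2} + 2h + 1,\] and consequently $|h^{\wedge}_{\pm}A| \geq h^2 + 3h + 2$.
   Context: For a finite set $A = \{a_1, \ldots, a_k\}$ of integers (with distinct $a_i$) and a positive integer $h$, the restricted $h$-fold signed sumset is \[h^{\wedge}_{\pm}A = \left\{ \sum_{i=1}^{k} \lambda_i a_i : \lambda_i \in \{ -1,0,1\}, \ \sum_{i=1}^{k} |\lambda_i| = h \right\}.\] -}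

module Defs where

open import Data.Nat using (ℕ; zero; suc)
open import Data.Integer using (ℤ; _+_; -_; +_)
open import Data.Integer.Properties using (_≟_)
open import Data.List using (List; []; _∷_; _++_; map; length; deduplicate)

-- All values Σ λᵢ aᵢ with λᵢ ∈ {-1,0,1} and exactly h nonzero λᵢ,
-- listed (with repetitions) by enumerating all coefficient choices.
-- The list xs enumerates the distinct elements a₁,…,a_k of A.
signedSums : ℕ → List ℤ → List ℤ
signedSums zero    []       = (+ 0) ∷ []
signedSums (suc h) []       = []
signedSums zero    (a ∷ as) = signedSums zero as
signedSums (suc h) (a ∷ as) =
  signedSums (suc h) as
  ++ map (λ s → a + s) (signedSums h as)
  ++ map (λ s → (- a) + s) (signedSums h as)

card : List ℤ → ℕ
card xs = length (deduplicate _≟_ xs)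

restrictedSignedSumsetSize : ℕ → List ℤ → ℕ
restrictedSignedSumsetSize h xs = card (signedSums h xs)

{-# OPTIONS --safe #-}
module Submission where

-- A signed sum of all h elements of A_r is
-- ≡ Σ A_r = Σ A − a_r (mod 2), while a signed sum of all of a₃, …, a_{h+1} and
-- exactly one of a₁, a₂ is ≡ Σ A − a₂ (mod 2).  As a_r ≢ a₁ ≡ a₂, both kinds are
-- disjoint parts of h^∧_± A, so |h^∧_± A| ≥ |h^∧_± A_r| + #(sums of the second kind).
-- Many sums of either kind are found by growing a chain: if a set has n elements below its
-- maximum M, t of them within 2x of M, then adding ±d for some d > x yields n + t
-- elements below M + d, t + 1 of them within 2d of M + d.  Adding a₃ < ⋯ < a_{h+1}
-- to {±a₁, ±a₂} gives h(h+1)/2 + 2h + 1 sums of the second kind, and adding the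
-- elements of A_r to {0} shows |h^∧_± A_r| ≥ h(h+1)/2 + 1.

open import Defs
open import Data.Nat using (ℕ; suc; _≤_; _≥_; _*_; _/_; _^_) renaming (_+_ to _+ℕ_; _<_ to _<ℕ_)
open import Data.Nat.Properties using () renaming (_≟_ to _≟ℕ_)
open import Data.Integer using (ℤ; +_; _-_; _<_)
open import Data.Integer.Divisibility using (_∣_)
open import Data.List using (List; map; upTo; filter)
open import Data.Product using (_×_)
open import Relation.Nullary using (¬_; ¬?)

open import Data.Nat.Base as ℕ using (zero; z≤n; s≤s)
import Data.Nat.Properties as ℕ
open import Data.Nat.DivMod using (m*n/n≡m)
import Data.Nat.Tactic.RingSolver as ℕ
open import Data.Integer.Base as ℤ using (0ℤ; -_; _+_)
import Data.Integer.Properties as ℤ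
import Data.Integer.Divisibility.Signed as Signed
open import Data.Integer.Tactic.RingSolver using (solve-∀)
open import Data.List using ([]; _∷_; _++_; length; foldr; drop; deduplicate)
open import Data.List.Properties
  using (length-map; length-++; length-upTo; map-upTo; filter-accept; filter-reject; filter-all; filter-notAll)
open import Data.List.Membership.Propositional using (_∈_; _∉_)
open import Data.List.Membership.Propositional.Properties
  using (∈-++⁺ˡ; ∈-++⁺ʳ; ∈-++⁻; ∈-map⁺; ∈-map⁻; ∈-upTo⁺; ∈-filter⁺;
         ∈-deduplicate⁺; ∈-deduplicate⁻)
open import Data.List.Relation.Unary.All as All using (All; []; _∷_)
import Data.List.Relation.Unary.All.Properties as All
open import Data.List.Relation.Unary.AllPairs as AllPairs using (AllPairs; []; _∷_)
import Data.List.Relation.Unary.AllPairs.Properties as AllPairs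
open import Data.List.Relation.Unary.Any as Any using (here; there)
open import Data.List.Relation.Unary.Linked using (Linked; [-]; _∷_)
open import Data.List.Relation.Unary.Linked.Properties using (AllPairs⇒Linked; Linked⇒AllPairs)
open import Data.List.Relation.Unary.Unique.Propositional using (Unique)
import Data.List.Relation.Unary.Unique.Propositional.Properties as Unique
open import Data.List.Relation.Unary.Unique.DecPropositional.Properties ℤ._≟_ using (deduplicate-!)
open import Data.List.Relation.Binary.Permutation.Propositional
  using (_↭_; ↭-reflexive; ↭-trans; ↭-prep; ↭-swap; ↭⇒↭ₛ)
import Data.List.Relation.Binary.Permutation.Propositional.Properties as ↭
import Data.List.Relation.Binary.Permutation.Setoid.Properties as ↭ₛ
open import Data.List.Relation.Binary.Sublist.Propositional using (_⊆_; []; _∷_; _∷ʳ_)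
import Data.List.Relation.Binary.Sublist.Propositional.Properties as Sublist
open import Data.Product using (_,_; ∃₂)
open import Data.Sum using (_⊎_; inj₁; inj₂; [_,_])
open import Function using (_∘_)
open import Relation.Binary.Definitions using (DecidableEquality)
open import Relation.Binary.PropositionalEquality
  using (_≡_; refl; sym; trans; cong; cong₂; subst; setoid; module ≡-Reasoning)
open import Relation.Nullary using (Dec; contradiction)

infix 4 _≡±_
_≡±_ : ℤ → ℤ → Set
c ≡± x = c ≡ x ⊎ c ≡ - x

∈-signedSums-skip : ∀ h x xs {v} → v ∈ signedSums h xs → v ∈ signedSums h (x ∷ xs)
∈-signedSums-skip zero    x xs v∈ = v∈
∈-signedSums-skip (suc h) x xs v∈ = ∈-++⁺ˡ v∈

∈-signedSums-∷⁺ : ∀ h x xs {c s} → c ≡± x → s ∈ signedSums h xs →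
                  c + s ∈ signedSums (suc h) (x ∷ xs)
∈-signedSums-∷⁺ h x xs (inj₁ refl) s∈ =
  ∈-++⁺ʳ (signedSums (suc h) xs) (∈-++⁺ˡ (∈-map⁺ (λ s → x + s) s∈))
∈-signedSums-∷⁺ h x xs (inj₂ refl) s∈ =
  ∈-++⁺ʳ (signedSums (suc h) xs)
    (∈-++⁺ʳ (map (λ s → x + s) (signedSums h xs)) (∈-map⁺ (λ s → - x + s) s∈))

∈-signedSums-∷⁻ : ∀ h x xs {v} → v ∈ signedSums (suc h) (x ∷ xs) →
                  v ∈ signedSums (suc h) xs ⊎
                  ∃₂ λ c s → c ≡± x × s ∈ signedSums h xs × v ≡ c + s
∈-signedSums-∷⁻ h x xs v∈ with ∈-++⁻ (signedSums (suc h) xs) v∈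
... | inj₁ v∈skip = inj₁ v∈skip
... | inj₂ v∈signed with ∈-++⁻ (map (λ s → x + s) (signedSums h xs)) v∈signed
...   | inj₁ v∈plus  = let s , s∈ , v≡ = ∈-map⁻ (λ s → x + s) v∈plus
                       in inj₂ (x , s , inj₁ refl , s∈ , v≡)
...   | inj₂ v∈minus = let s , s∈ , v≡ = ∈-map⁻ (λ s → - x + s) v∈minus
                       in inj₂ (- x , s , inj₂ refl , s∈ , v≡)

∉-signedSums-long : ∀ h xs {v} → length xs <ℕ h → v ∉ signedSums h xs
∉-signedSums-long (suc h) []       _            ()
∉-signedSums-long (suc h) (x ∷ xs) (s≤s |xs|<h) v∈ with ∈-signedSums-∷⁻ h x xs v∈
... | inj₁ v∈skip               = ∉-signedSums-long (suc h) xs (ℕ.m<n⇒m<1+n |xs|<h) v∈skip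
... | inj₂ (_ , _ , _ , s∈ , _) = ∉-signedSums-long h xs |xs|<h s∈

signedSums-⊆ : ∀ h {xs ys v} → xs ⊆ ys → v ∈ signedSums h xs → v ∈ signedSums h ys
signedSums-⊆ h       []                       v∈ = v∈
signedSums-⊆ h       (_∷ʳ_ {ys = ys} y xs⊆ys) v∈ = ∈-signedSums-skip h y ys (signedSums-⊆ h xs⊆ys v∈)
signedSums-⊆ zero    (refl ∷ xs⊆ys)           v∈ = signedSums-⊆ zero xs⊆ys v∈
signedSums-⊆ (suc h) (_∷_ {x} {xs} {ys = ys} refl xs⊆ys) v∈ with ∈-signedSums-∷⁻ h x xs v∈
... | inj₁ v∈skip = ∈-signedSums-skip (suc h) x ys (signedSums-⊆ (suc h) xs⊆ys v∈skip)
... | inj₂ (c , s , c≡±x , s∈ , refl) = ∈-signedSums-∷⁺ h x ys c≡±x (signedSums-⊆ h xs⊆ys s∈)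

sum : List ℤ → ℤ
sum = foldr _+_ 0ℤ

Even : ℤ → Set
Even z = + 2 Signed.∣ z

signedSums-parity : ∀ xs {v} → v ∈ signedSums (length xs) xs → Even (v - sum xs)
signedSums-parity []       (here refl) = Signed.divides 0ℤ refl
signedSums-parity (x ∷ xs) v∈ with ∈-signedSums-∷⁻ (length xs) x xs v∈
... | inj₁ v∈skip = contradiction v∈skip (∉-signedSums-long (suc (length xs)) xs ℕ.≤-refl)
... | inj₂ (_ , s , inj₁ refl , s∈ , refl) =
  subst Even (shift x s (sum xs)) (signedSums-parity xs s∈)
  where
  shift : ∀ x s t → s - t ≡ (x + s) - (x + t)
  shift = solve-∀
... | inj₂ (_ , s , inj₂ refl , s∈ , refl) =
  subst Even (shift x s (sum xs))
    (Signed.∣m∣n⇒∣m+n (signedSums-parity xs s∈) (Signed.∣n⇒∣m*n (- x) Signed.∣-refl))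
  where
  shift : ∀ x s t → (s - t) + (- x) ℤ.* + 2 ≡ (- x + s) - (x + t)
  shift = solve-∀

Even-≡± : ∀ {c x} → c ≡± x → Even (c - x)
Even-≡± {x = x} (inj₁ refl) = Signed.divides 0ℤ (ℤ.+-inverseʳ x)
Even-≡± {x = x} (inj₂ refl) = Signed.divides (- x) (double (- x))
  where
  double : ∀ y → y + y ≡ y ℤ.* + 2
  double = solve-∀

Even-pair : ∀ {u x y} → u ≡± x ⊎ u ≡± y → Even (x - y) → Even (u - x)
Even-pair (inj₁ u≡±x) _ = Even-≡± u≡±x
Even-pair {u} {x} {y} (inj₂ u≡±y) x≡y =
  subst Even (cancel u x y) (Signed.∣m∣n⇒∣m-n (Even-≡± u≡±y) x≡y)
  where
  cancel : ∀ u x y → u - y - (x - y) ≡ u - x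
  cancel = solve-∀

-- Modulo 2: s ≡ u + w ≡ x + t, hence z ≡ y ≡ x.
Even-exchange : ∀ z x y u w s t → z + s ≡ x + (y + t) → Even (x - y) →
                Even (u - x) → Even (w - t) → Even (u + w - s) → Even (z - x)
Even-exchange z x y u w s t z+s≡ x≡y u≡x w≡t u+w≡s =
  subst Even (sym z-x≡e)
    (Signed.∣m∣n⇒∣m-n (Signed.∣m∣n⇒∣m-n u+w≡s (Signed.∣m∣n⇒∣m+n u≡x w≡t)) x≡y)
  where
  open ≡-Reasoning
  e = u + w - s - ((u - x) + (w - t)) - (x - y)
  regroup : ∀ z x y u w s t →
            z - x ≡ (u + w - s - ((u - x) + (w - t)) - (x - y)) + (z + s - (x + (y + t)))
  regroup = solve-∀
  z-x≡e : z - x ≡ e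
  z-x≡e = begin
    z - x                             ≡⟨ regroup z x y u w s t ⟩
    e + (z + s - (x + (y + t)))       ≡⟨ cong (λ l → e + (l - (x + (y + t)))) z+s≡ ⟩
    e + (x + (y + t) - (x + (y + t))) ≡⟨ cong (λ l → e + l) (ℤ.+-inverseʳ (x + (y + t))) ⟩
    e + 0ℤ                            ≡⟨ ℤ.+-identityʳ e ⟩
    e                                 ∎

record Chain (P : ℤ → Set) (n : ℕ) : Set where
  field
    elements        : List ℤ
    sorted          : AllPairs _<_ elements
    members         : All P elements
    length-elements : length elements ≡ n

open Chain

module _ {P Q : ℤ → Set} where

  Chain-map : ∀ {n} → (∀ {v} → P v → Q v) → Chain P n → Chain Q n
  Chain-map P⇒Q C = record
    { elements        = elements C
    ; sorted          = sorted C
    ; members         = All.map P⇒Q (members C)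
    ; length-elements = length-elements C
    }

  Chain-shift : ∀ {n} d → (∀ {v} → P v → Q (v + d)) → Chain P n → Chain Q n
  Chain-shift d P⇒Q C = record
    { elements        = map (_+ d) (elements C)
    ; sorted          = AllPairs.map⁺ (AllPairs.map (ℤ.+-monoˡ-< d) (sorted C))
    ; members         = All.map⁺ (All.map P⇒Q (members C))
    ; length-elements = trans (length-map (_+ d) (elements C)) (length-elements C)
    }

  Chain-++ : ∀ {n k} → Chain P n → Chain Q k → (∀ {p q} → P p → Q q → p < q) →
             Chain (λ v → P v ⊎ Q v) (n +ℕ k)
  Chain-++ C D P<Q = record
    { elements        = elements C ++ elements D
    ; sorted          = AllPairs.++⁺ (sorted C) (sorted D)
                          (All.map (λ p → All.map (P<Q p) (members D)) (members C))
    ; members         = All.++⁺ (All.map inj₁ (members C)) (All.map inj₂ (members D))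
    ; length-elements = trans (length-++ (elements C))
                          (cong₂ _+ℕ_ (length-elements C) (length-elements D))
    }

Chain-[_] : ∀ v → Chain (_≡ v) 1
Chain-[ v ] = record
  { elements = v ∷ [] ; sorted = [] ∷ [] ; members = refl ∷ [] ; length-elements = refl }

_±_ : (ℤ → Set) → ℤ → ℤ → Set
(B ± d) v = ∃₂ λ u c → B u × c ≡± d × v ≡ u + c

-- B + k^∧_± xs for k = length xs, i.e. every element of xs occurs with a sign.
_⊕±_ : (ℤ → Set) → List ℤ → ℤ → Set
(B ⊕± xs) v = ∃₂ λ u w → B u × w ∈ signedSums (length xs) xs × v ≡ u + w

record Ladder (B : ℤ → Set) (x : ℤ) (n t : ℕ) : Set where
  field
    top    : ℤ
    top∈   : B top
    rungs  : Chain (λ v → B v × v ℤ.≤ top) n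
    window : Chain (λ w → B w × w ℤ.≤ top × top ℤ.≤ w + (x + x)) t

m-d≤m+d : ∀ m {d} → 0ℤ ℤ.≤ d → m - d ℤ.≤ m + d
m-d≤m+d m 0≤d = ℤ.+-monoʳ-≤ m (ℤ.≤-trans (ℤ.neg-mono-≤ 0≤d) 0≤d)

m-d<w+d : ∀ {m x d} w → m ℤ.≤ w + (x + x) → x < d → m - d < w + d
m-d<w+d {m} {x} {d} w m≤ x<d = begin-strict
  m - d            ≤⟨ ℤ.+-monoˡ-≤ (- d) m≤ ⟩
  w + (x + x) - d  <⟨ ℤ.+-monoˡ-< (- d) (ℤ.+-monoʳ-< w (ℤ.+-mono-< x<d x<d)) ⟩
  w + (d + d) - d  ≡⟨ cancel w d ⟩
  w + d            ∎
  where
  open ℤ.≤-Reasoning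
  cancel : ∀ w d → w + (d + d) - d ≡ w + d
  cancel = solve-∀

m+d≤v+2d : ∀ m d {v} → m - d ℤ.≤ v → m + d ℤ.≤ v + (d + d)
m+d≤v+2d m d {v} m-d≤v = begin
  m + d            ≡⟨ uncancel m d ⟩
  m - d + (d + d)  ≤⟨ ℤ.+-monoˡ-≤ (d + d) m-d≤v ⟩
  v + (d + d)      ∎
  where
  open ℤ.≤-Reasoning
  uncancel : ∀ m d → m + d ≡ m - d + (d + d)
  uncancel = solve-∀

-- The rungs lowered by d stay ≤ top − d, while the window raised by d lies above
-- top − d because d > x; so both fit in one chain, and top − d joins the new window.
ladder-step : ∀ {B x n t d} → 0ℤ ℤ.≤ d → x < d → Ladder B x n t →
              Ladder (B ± d) d (n +ℕ t) (suc t)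
ladder-step {B} {x} {n} {t} {d} 0≤d x<d L = record
  { top    = top + d
  ; top∈   = top , d , top∈ , inj₁ refl , refl
  ; rungs  = Chain-map [ (λ (b , v≤) → b , ℤ.≤-trans v≤ (m-d≤m+d top 0≤d))
                       , (λ (b , v≤ , _) → b , v≤) ]
               (Chain-++ lowered raised (λ (_ , p≤) (_ , _ , <q) → ℤ.≤-<-trans p≤ <q))
  ; window = Chain-map [ (λ { refl → lowered-top , m-d≤m+d top 0≤d , m+d≤v+2d top d ℤ.≤-refl })
                       , (λ (b , v≤ , <v) → b , v≤ , m+d≤v+2d top d (ℤ.<⇒≤ <v)) ]
               (Chain-++ Chain-[ top - d ] raised (λ { refl (_ , _ , <q) → <q }))
  }
  where
  open Ladder L
  lowered-top : (B ± d) (top - d)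
  lowered-top = top , - d , top∈ , inj₂ refl , refl
  lowered : Chain (λ v → (B ± d) v × v ℤ.≤ top - d) n
  lowered = Chain-shift (- d)
    (λ (b , v≤) → (_ , - d , b , inj₂ refl , refl) , ℤ.+-monoˡ-≤ (- d) v≤) rungs
  raised : Chain (λ v → (B ± d) v × v ℤ.≤ top + d × top - d < v) t
  raised = Chain-shift d
    (λ {w} (b , w≤ , near) → (w , d , b , inj₁ refl , refl) , ℤ.+-monoˡ-≤ d w≤ , m-d<w+d w near x<d)
    window

⊕±-[] : ∀ {B v} → B v → (B ⊕± []) v
⊕±-[] {v = v} b = v , 0ℤ , b , here refl , sym (ℤ.+-identityʳ v)

⊕±-∷ : ∀ {B} d ds {v} → ((B ± d) ⊕± ds) v → (B ⊕± (d ∷ ds)) v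
⊕±-∷ d ds (_ , w , (u , c , b , c≡±d , refl) , w∈ , refl) =
  u , c + w , b , ∈-signedSums-∷⁺ (length ds) d ds c≡±d w∈ , ℤ.+-assoc u c w

ladderCount : ℕ → ℕ → ℕ → ℕ
ladderCount n t zero    = n
ladderCount n t (suc k) = ladderCount (n +ℕ t) (suc t) k

climb : ∀ {B x n t} → 0ℤ ℤ.≤ x → Ladder B x n t → ∀ ds → Linked _<_ (x ∷ ds) →
        Chain (B ⊕± ds) (ladderCount n t (length ds))
climb 0≤x L []       _            = Chain-map (λ (b , _) → ⊕±-[] b) (Ladder.rungs L)
climb 0≤x L (d ∷ ds) (x<d ∷ link) =
  Chain-map (⊕±-∷ d ds) (climb 0≤d (ladder-step 0≤d x<d L) ds link)
  where 0≤d = ℤ.≤-trans 0≤x (ℤ.<⇒≤ x<d)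

ladderWithin : ∀ {B M ws} → B M → AllPairs _<_ ws →
               All (λ w → B w × - M ℤ.≤ w × w ℤ.≤ M) ws → Ladder B M (length ws) (length ws)
ladderWithin {B} {M} {ws} M∈B ws-sorted bounded = record
  { top    = M
  ; top∈   = M∈B
  ; rungs  = record { elements = ws ; sorted = ws-sorted ; length-elements = refl
                    ; members = All.map (λ (b , _ , w≤M) → b , w≤M) bounded }
  ; window = record { elements = ws ; sorted = ws-sorted ; length-elements = refl
                    ; members = All.map (λ {w} (b , -M≤w , w≤M) → b , w≤M , M≤w+2M w -M≤w)
                                        bounded }
  }
  where
  open ℤ.≤-Reasoning
  uncancel : ∀ M → M ≡ - M + (M + M)
  uncancel = solve-∀
  M≤w+2M : ∀ w → - M ℤ.≤ w → M ℤ.≤ w + (M + M)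
  M≤w+2M w -M≤w = begin
    M              ≡⟨ uncancel M ⟩
    - M + (M + M)  ≤⟨ ℤ.+-monoˡ-≤ (M + M) -M≤w ⟩
    w + (M + M)    ∎

pairLadder : ∀ {x y} → + 0 < x → x < y → Ladder (λ u → u ≡± x ⊎ u ≡± y) y 4 4
pairLadder {x} {y} 0<x x<y = ladderWithin (inj₂ (inj₁ refl))
  (Linked⇒AllPairs ℤ.<-trans (-y<-x ∷ -x<x ∷ x<y ∷ [-]))
  ( (inj₂ (inj₂ refl) , ℤ.≤-refl    , ℤ.<⇒≤ -y<y)
  ∷ (inj₁ (inj₂ refl) , ℤ.<⇒≤ -y<-x , ℤ.<⇒≤ (ℤ.<-trans -x<x x<y))
  ∷ (inj₁ (inj₁ refl) , ℤ.<⇒≤ -y<x  , ℤ.<⇒≤ x<y)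
  ∷ (inj₂ (inj₁ refl) , ℤ.<⇒≤ -y<y  , ℤ.≤-refl)
  ∷ [])
  where
  -y<-x = ℤ.neg-mono-< x<y
  -x<x  = ℤ.<-trans (ℤ.neg-mono-< 0<x) 0<x
  -y<x  = ℤ.<-trans -y<-x -x<x
  -y<y  = ℤ.<-trans -y<x x<y

⊕±-pair⇒signedSums : ∀ {x y} zs {v} → ((λ u → u ≡± x ⊎ u ≡± y) ⊕± zs) v →
                     v ∈ signedSums (suc (length zs)) (x ∷ y ∷ zs)
⊕±-pair⇒signedSums {x} {y} zs (u , w , inj₁ u≡±x , w∈ , refl) =
  ∈-signedSums-∷⁺ (length zs) x (y ∷ zs) u≡±x (∈-signedSums-skip (length zs) y zs w∈)
⊕±-pair⇒signedSums {x} {y} zs (u , w , inj₂ u≡±y , w∈ , refl) =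
  ∈-signedSums-skip (suc (length zs)) x (y ∷ zs) (∈-signedSums-∷⁺ (length zs) y zs u≡±y w∈)

⊕±-0⇒signedSums : ∀ zs {v} → ((_≡ 0ℤ) ⊕± zs) v → v ∈ signedSums (length zs) zs
⊕±-0⇒signedSums zs (_ , w , refl , w∈ , refl) = subst (_∈ _) (sym (ℤ.+-identityˡ w)) w∈

module _ {A : Set} (_≟_ : DecidableEquality A) where

  unique⇒length≤ : ∀ {xs ys : List A} → Unique xs → All (_∈ ys) xs → length xs ≤ length ys
  unique⇒length≤ {[]}     _            _              = z≤n
  unique⇒length≤ {x ∷ xs} {ys} (x∉xs ∷ xs!) (x∈ys ∷ xs⊆ys) =
    ℕ.≤-trans (s≤s |xs|≤) (filter-notAll ≢x? ys (Any.map (λ x≡y y≢x → y≢x (sym x≡y)) x∈ys))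
    where
    ≢x? = λ y → ¬? (y ≟ x)
    |xs|≤ : length xs ≤ length (filter ≢x? ys)
    |xs|≤ = unique⇒length≤ xs! (All.zipWith
      (λ (x≢y , y∈ys) → ∈-filter⁺ ≢x? y∈ys (λ y≡x → x≢y (sym y≡x))) (x∉xs , xs⊆ys))

  ↭-filter≢ : ∀ {x xs} → Unique xs → x ∈ xs → xs ↭ x ∷ filter (λ y → ¬? (y ≟ x)) xs
  ↭-filter≢ {x} {_ ∷ xs} (x∉xs ∷ _) (here refl) = ↭-reflexive (cong (x ∷_) (sym (begin
    filter ≢x? (x ∷ xs)  ≡⟨ filter-reject ≢x? (λ x≢x → x≢x refl) ⟩
    filter ≢x? xs        ≡⟨ filter-all ≢x? (All.map (λ x≢y y≡x → x≢y (sym y≡x)) x∉xs) ⟩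
    xs                   ∎)))
    where
    open ≡-Reasoning
    ≢x? = λ y → ¬? (y ≟ x)
  ↭-filter≢ {x} {y ∷ xs} (y∉xs ∷ xs!) (there x∈xs) =
    ↭-trans (↭-prep y (↭-filter≢ xs! x∈xs)) (↭-trans (↭-swap y x (↭-reflexive refl))
      (↭-reflexive (cong (x ∷_) (sym (filter-accept (λ y → ¬? (y ≟ x)) (All.lookup y∉xs x∈xs))))))

Chain⇒≤card : ∀ {P n xs} → Chain P n → (∀ {v} → P v → v ∈ xs) → n ≤ card xs
Chain⇒≤card C P⊆xs = subst (_≤ _) (length-elements C)
  (unique⇒length≤ ℤ._≟_ (AllPairs.map ℤ.<⇒≢ (sorted C))
    (All.map (∈-deduplicate⁺ ℤ._≟_ ∘ P⊆xs) (members C)))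

Chain⇒+card≤card : ∀ {P n xs ys} → Chain P n → (∀ {v} → P v → v ∈ xs) →
                   (∀ {v} → P v → v ∉ ys) → (∀ {y} → y ∈ ys → y ∈ xs) →
                   n +ℕ card ys ≤ card xs
Chain⇒+card≤card {xs = xs} {ys} C P⊆xs P∉ys ys⊆xs =
  subst (λ n → n +ℕ card ys ≤ card xs) (length-elements C)
    (subst (_≤ card xs) (length-++ (elements C)) (unique⇒length≤ ℤ._≟_ unique included))
  where
  dedup = deduplicate ℤ._≟_
  unique : Unique (elements C ++ dedup ys)
  unique = Unique.++⁺ (AllPairs.map ℤ.<⇒≢ (sorted C)) (deduplicate-! ys)
    (λ (v∈C , v∈ys) → All.lookup (All.map P∉ys (members C)) v∈C
                        (∈-deduplicate⁻ ℤ._≟_ ys v∈ys))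
  included : All (_∈ dedup xs) (elements C ++ dedup ys)
  included = All.++⁺ (All.map (∈-deduplicate⁺ ℤ._≟_ ∘ P⊆xs) (members C))
    (All.tabulate (∈-deduplicate⁺ ℤ._≟_ ∘ ys⊆xs ∘ ∈-deduplicate⁻ ℤ._≟_ ys))
triangular : ℕ → ℕ
triangular zero    = 0
triangular (suc k) = suc k +ℕ triangular k

triangular-double : ∀ k → triangular k +ℕ triangular k ≡ k * (k +ℕ 1)
triangular-double zero    = refl
triangular-double (suc k) = begin
  (suc k +ℕ t) +ℕ (suc k +ℕ t)  ≡⟨ regroup k t ⟩
  (t +ℕ t) +ℕ 2 * suc k          ≡⟨ cong (_+ℕ 2 * suc k) (triangular-double k) ⟩
  k * (k +ℕ 1) +ℕ 2 * suc k      ≡⟨ expand k ⟩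
  suc k * (suc k +ℕ 1)           ∎
  where
  open ≡-Reasoning
  t = triangular k
  regroup : ∀ k t → (suc k +ℕ t) +ℕ (suc k +ℕ t) ≡ (t +ℕ t) +ℕ 2 * suc k
  regroup = ℕ.solve-∀
  expand : ∀ k → k * (k +ℕ 1) +ℕ 2 * suc k ≡ suc k * (suc k +ℕ 1)
  expand = ℕ.solve-∀

triangular≡/2 : ∀ k → k * (k +ℕ 1) / 2 ≡ triangular k
triangular≡/2 k = begin
  k * (k +ℕ 1) / 2  ≡⟨ cong (_/ 2) (sym (triangular-double k)) ⟩
  (t +ℕ t) / 2      ≡⟨ cong (_/ 2) (double t) ⟩
  t * 2 / 2         ≡⟨ m*n/n≡m t 2 ⟩
  t                 ∎
  where
  open ≡-Reasoning
  t = triangular k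
  double : ∀ t → t +ℕ t ≡ t * 2
  double = ℕ.solve-∀

ladderCount-closed : ∀ n t k → ladderCount n t k +ℕ k ≡ n +ℕ k * t +ℕ triangular k
ladderCount-closed n t zero    = base n t
  where
  base : ∀ n t → n +ℕ 0 ≡ n +ℕ 0 * t +ℕ 0
  base = ℕ.solve-∀
ladderCount-closed n t (suc k) = begin
  ladderCount (n +ℕ t) (suc t) k +ℕ suc k    ≡⟨ ℕ.+-suc _ k ⟩
  suc (ladderCount (n +ℕ t) (suc t) k +ℕ k)  ≡⟨ cong suc (ladderCount-closed (n +ℕ t) (suc t) k) ⟩
  suc (n +ℕ t +ℕ k * suc t +ℕ triangular k)  ≡⟨ regroup n t k (triangular k) ⟩
  n +ℕ suc k * t +ℕ (suc k +ℕ triangular k)  ∎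
  where
  open ≡-Reasoning
  regroup : ∀ n t k T → suc (n +ℕ t +ℕ k * suc t +ℕ T) ≡ n +ℕ suc k * t +ℕ (suc k +ℕ T)
  regroup = ℕ.solve-∀

ladderCount-1-1 : ∀ h → ladderCount 1 1 h ≡ triangular h +ℕ 1
ladderCount-1-1 h =
  ℕ.+-cancelʳ-≡ h _ _ (trans (ladderCount-closed 1 1 h) (regroup h (triangular h)))
  where
  regroup : ∀ h T → 1 +ℕ h * 1 +ℕ T ≡ T +ℕ 1 +ℕ h
  regroup = ℕ.solve-∀

ladderCount-4-4 : ∀ m → ladderCount 4 4 m ≡ triangular (suc m) +ℕ 2 * suc m +ℕ 1
ladderCount-4-4 m =
  ℕ.+-cancelʳ-≡ m _ _ (trans (ladderCount-closed 4 4 m) (regroup m (triangular m)))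
  where
  regroup : ∀ m T → 4 +ℕ m * 4 +ℕ T ≡ (suc m +ℕ T) +ℕ 2 * suc m +ℕ 1 +ℕ m
  regroup = ℕ.solve-∀

ladderCount-pair : ∀ m c →
                   c +ℕ suc m * (suc m +ℕ 1) / 2 +ℕ 2 * suc m +ℕ 1 ≡ ladderCount 4 4 m +ℕ c
ladderCount-pair m c = begin
  c +ℕ h * (h +ℕ 1) / 2 +ℕ 2 * h +ℕ 1  ≡⟨ cong (λ s → c +ℕ s +ℕ 2 * h +ℕ 1) (triangular≡/2 h) ⟩
  c +ℕ t +ℕ 2 * h +ℕ 1                 ≡⟨ regroup c t h ⟩
  (t +ℕ 2 * h +ℕ 1) +ℕ c               ≡⟨ cong (_+ℕ c) (sym (ladderCount-4-4 m)) ⟩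
  ladderCount 4 4 m +ℕ c               ∎
  where
  open ≡-Reasoning
  h = suc m
  t = triangular h
  regroup : ∀ c s n → c +ℕ s +ℕ 2 * n +ℕ 1 ≡ (s +ℕ 2 * n +ℕ 1) +ℕ c
  regroup = ℕ.solve-∀

ladderCounts : ∀ m → ladderCount 4 4 m +ℕ ladderCount 1 1 (suc m) ≡ suc m ^ 2 +ℕ 3 * suc m +ℕ 2
ladderCounts m = begin
  ladderCount 4 4 m +ℕ ladderCount 1 1 h  ≡⟨ cong₂ _+ℕ_ (ladderCount-4-4 m) (ladderCount-1-1 h) ⟩
  (t +ℕ 2 * h +ℕ 1) +ℕ (t +ℕ 1)           ≡⟨ regroup t h ⟩
  (t +ℕ t) +ℕ 2 * h +ℕ 2                  ≡⟨ cong (λ s → s +ℕ 2 * h +ℕ 2) (triangular-double h) ⟩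
  h * (h +ℕ 1) +ℕ 2 * h +ℕ 2              ≡⟨ expand h ⟩
  h ^ 2 +ℕ 3 * h +ℕ 2                     ∎
  where
  open ≡-Reasoning
  h = suc m
  t = triangular h
  regroup : ∀ s n → (s +ℕ 2 * n +ℕ 1) +ℕ (s +ℕ 1) ≡ (s +ℕ s) +ℕ 2 * n +ℕ 2
  regroup = ℕ.solve-∀
  expand : ∀ n → n * (n +ℕ 1) +ℕ 2 * n +ℕ 2 ≡ n * (n * 1) +ℕ 3 * n +ℕ 2
  expand = ℕ.solve-∀

values-rising : ∀ {a : ℕ → ℤ} {is} → All (λ i → + 0 < a i) is →
                AllPairs (λ i j → a i < a j) is → AllPairs _<_ (+ 0 ∷ map a is)
values-rising positive increasing = All.map⁺ positive ∷ AllPairs.map⁺ increasing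

module Increasing {m : ℕ} {a : ℕ → ℤ}
  (pos  : ∀ i → 1 ≤ i → i ≤ suc (suc m) → + 0 < a i)
  (mono : ∀ i j → 1 ≤ i → i <ℕ j → j ≤ suc (suc m) → a i < a j) where

  h : ℕ
  h = suc m

  indices : List ℕ
  indices = map suc (upTo (suc h))

  values : List ℤ
  values = map a indices

  _≢?_ : ∀ i r → Dec (¬ i ≡ r)
  i ≢? r = ¬? (i ≟ℕ r)

  removed : ℕ → List ℤ
  removed r = map a (filter (_≢? r) indices)

  positive : All (λ i → + 0 < a i) indices
  positive = subst (All _) (sym (map-upTo suc (suc h)))
    (All.applyUpTo⁺₁ suc (suc h) (λ i<n → pos _ (s≤s z≤n) i<n))

  increasing : AllPairs (λ i j → a i < a j) indices
  increasing = subst (AllPairs _) (sym (map-upTo suc (suc h)))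
    (AllPairs.applyUpTo⁺₁ suc (suc h) (λ i<j j<n → mono _ _ (s≤s z≤n) (s≤s i<j) j<n))

  length-values : length values ≡ suc h
  length-values =
    trans (length-map a indices) (trans (length-map suc (upTo (suc h))) (length-upTo (suc h)))

  values-↭ : ∀ {r} → 1 ≤ r → r ≤ suc h → values ↭ a r ∷ removed r
  values-↭ {suc r} (s≤s z≤n) r<n = ↭.map⁺ a (↭-filter≢ _≟ℕ_
    (Unique.map⁺ ℕ.suc-injective (Unique.upTo⁺ (suc h))) (∈-map⁺ suc (∈-upTo⁺ r<n)))

  length-removed : ∀ {r} → 1 ≤ r → r ≤ suc h → length (removed r) ≡ h
  length-removed 1≤r r≤ =
    ℕ.suc-injective (trans (sym (↭.↭-length (values-↭ 1≤r r≤))) length-values)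

  sum-values : ∀ {r} → 1 ≤ r → r ≤ suc h → sum values ≡ a r + sum (removed r)
  sum-values 1≤r r≤ =
    ↭ₛ.foldr-commMonoid (setoid ℤ) ℤ.+-0-isCommutativeMonoid (↭⇒↭ₛ (values-↭ 1≤r r≤))

  removed-bound : ∀ {r} → 1 ≤ r → r ≤ suc h → ladderCount 1 1 h ≤ card (signedSums h (removed r))
  removed-bound {r} 1≤r r≤ = Chain⇒≤card (subst (Chain Z ∘ ladderCount 1 1) |Aᵣ| chain)
    (λ v∈ → subst (λ k → _ ∈ signedSums k (removed r)) |Aᵣ| (⊕±-0⇒signedSums (removed r) v∈))
    where
    Z = (_≡ 0ℤ) ⊕± removed r
    |Aᵣ| = length-removed 1≤r r≤
    chain : Chain Z (ladderCount 1 1 (length (removed r)))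
    chain = climb ℤ.≤-refl (ladderWithin refl ([] ∷ []) ((refl , ℤ.≤-refl , ℤ.≤-refl) ∷ []))
      (removed r) (AllPairs⇒Linked
        (values-rising (All.filter⁺ (_≢? r) positive) (AllPairs.filter⁺ (_≢? r) increasing)))

  pair-bound : ∀ {r} → Even (a 1 - a 2) → ¬ Even (a r - a 1) → 1 ≤ r → r ≤ suc h →
               ladderCount 4 4 m +ℕ card (signedSums h (removed r)) ≤ card (signedSums h values)
  pair-bound {r} a₁≡a₂ aᵣ≢a₁ 1≤r r≤ =
    Chain⇒+card≤card (subst (Chain Y ∘ ladderCount 4 4) |ds| chain)
    (λ v∈ → subst (λ k → _ ∈ signedSums (suc k) values) |ds| (⊕±-pair⇒signedSums ds v∈))
    disjoint (signedSums-⊆ h (Sublist.map⁺ a (Sublist.filter-⊆ (_≢? r) indices)))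
    where
    rising = values-rising positive increasing
    0<a₁   = All.head (AllPairs.head rising)
    a₁<a₂  = All.head (AllPairs.head (AllPairs.tail rising))
    ds     = drop 2 values
    Y      = (λ u → u ≡± a 1 ⊎ u ≡± a 2) ⊕± ds
    |ds| : length ds ≡ m
    |ds| = ℕ.suc-injective (ℕ.suc-injective length-values)
    chain : Chain Y (ladderCount 4 4 (length ds))
    chain = climb (ℤ.<⇒≤ (ℤ.<-trans 0<a₁ a₁<a₂)) (pairLadder 0<a₁ a₁<a₂) ds
      (AllPairs⇒Linked (AllPairs.tail (AllPairs.tail rising)))
    disjoint : ∀ {v} → Y v → v ∉ signedSums h (removed r)
    disjoint (u , w , u∈ , w∈ , refl) u+w∈ = aᵣ≢a₁
      (Even-exchange (a r) (a 1) (a 2) u w (sum (removed r)) (sum ds) (sym (sum-values 1≤r r≤))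
        a₁≡a₂ (Even-pair u∈ a₁≡a₂) (signedSums-parity ds w∈) (signedSums-parity (removed r)
          (subst (λ k → u + w ∈ signedSums k (removed r)) (sym (length-removed 1≤r r≤)) u+w∈)))

lemma1 : (h : ℕ) → 3 ≤ h → (a : ℕ → ℤ)
    → (∀ i → 1 ≤ i → i ≤ suc h → + 0 < a i)
    → (∀ i j → 1 ≤ i → i <ℕ j → j ≤ suc h → a i < a j)
    → (+ 2) ∣ (a 1 - a 2)
    → (r : ℕ) → 3 ≤ r → r ≤ suc h → ¬ ((+ 2) ∣ (a r - a 1))
    → (restrictedSignedSumsetSize h (map a (map suc (upTo (suc h))))
         ≥ restrictedSignedSumsetSize h
             (map a (filter (λ i → ¬? (i ≟ℕ r)) (map suc (upTo (suc h)))))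
           +ℕ (h * (h +ℕ 1)) / 2 +ℕ 2 * h +ℕ 1)
      × (restrictedSignedSumsetSize h (map a (map suc (upTo (suc h))))
           ≥ h ^ 2 +ℕ 3 * h +ℕ 2)
lemma1 zero    ()
lemma1 (suc m) _ a pos mono 2∣a₁-a₂ r 3≤r r≤h+1 2∤aᵣ-a₁ =
  subst (_≤ |A|) (sym (ladderCount-pair m |Aᵣ|)) pair ,
  subst (_≤ |A|) (ladderCounts m) (ℕ.≤-trans (ℕ.+-monoʳ-≤ (ladderCount 4 4 m) single) pair)
  where
  open Increasing pos mono
  |A|  = card (signedSums h values)
  |Aᵣ| = card (signedSums h (removed r))
  1≤r  = ℕ.≤-trans (s≤s z≤n) 3≤r
  single : ladderCount 1 1 h ≤ |Aᵣ|
  single = removed-bound 1≤r r≤h+1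
  pair : ladderCount 4 4 m +ℕ |Aᵣ| ≤ |A|
  pair = pair-bound (Signed.∣ᵤ⇒∣ 2∣a₁-a₂) (2∤aᵣ-a₁ ∘ Signed.∣⇒∣ᵤ) 1≤r r≤h+1
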